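{- Let $x_1 \ge x_2 \ge \cdots \ge x_n \ge 0$ be integers such that for some subset $S \subset [n]$ of size $q$, all $x_i$ with $i \in S$ equal $0$. Suppose that we increase $x_i$ by $1$ for all $i \in S$. Then $\Phi = \sum_{i=1}^n x_i^2$ increases by exactly $q$, and $\Psi = n \sum_i |x_i| + \sum_{i<j} |x_i - x_j|$ increases by at least $q^2$. -}

module Defs where

open import Data.Nat using (ℕ; zero; suc; _+_; _*_; _<ᵇ_; ∣_-_∣)
open import Data.Fin using (Fin; toℕ)
import Data.Fin as F
open import Data.Bool using (if_then_else_)
open import Data.Vec using (lookup)
open import Data.Fin.Subset using (Subset)

∑ : ∀ {n} → (Fin n → ℕ) → ℕ
∑ {zero}  f = 0
∑ {suc n} f = f F.zero + ∑ (λ i → f (F.suc i))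

∑pairs : ∀ {n} → (Fin n → Fin n → ℕ) → ℕ
∑pairs f = ∑ λ i → ∑ λ j → if toℕ i <ᵇ toℕ j then f i j else 0

Φ : ∀ {n} → (Fin n → ℕ) → ℕ
Φ x = ∑ λ i → x i * x i

-- Ψ = n Σ |x_i| + Σ_{i<j} |x_i - x_j|  (x_i ∈ ℕ so |x_i| = x_i)
Ψ : ∀ {n} → (Fin n → ℕ) → ℕ
Ψ {n} x = n * ∑ x + ∑pairs (λ i j → ∣ x i - x j ∣)

bump : ∀ {n} → Subset n → (Fin n → ℕ) → Fin n → ℕ
bump S x i = x i + (if lookup S i then 1 else 0)

-- Φ: an entry raised from 0 to 1 adds exactly 1 to its square.
-- Ψ: the first term grows by n q.  Writing b for the indicator vector of S, the
-- triangle inequality bounds the loss in the pair term by Σ_{i<j} |b_i - b_j|,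
-- which counts the pairs split by S, that is q (n - q).  Hence Ψ grows by at
-- least n q - q (n - q) = q².  Neither part uses that x is non-increasing.
{-# OPTIONS --safe #-}
module Submission where

open import Defs
open import Data.Nat using (ℕ; zero; suc; _+_; _*_; _≤_; z≤n; _<ᵇ_; ∣_-_∣)
open import Data.Nat.Properties
  using ( ≤-refl; +-mono-≤; +-monoˡ-≤; +-monoʳ-≤; +-identityʳ; +-comm; *-suc; m+[n∸m]≡n
        ; +-commutativeSemigroup; ∣-∣-triangle; ∣-∣-comm; ∣m+n-m+o∣≡∣n-o∣; module ≤-Reasoning)
open import Data.Nat.Tactic.RingSolver using (solve-∀)
open import Algebra.Properties.CommutativeSemigroup +-commutativeSemigroup using (interchange)
open import Data.Bool using (true; false; if_then_else_)
open import Data.Fin using (Fin; toℕ)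
import Data.Fin as F
open import Data.Fin.Subset using (Subset; _∈_; ∣_∣; ∁)
open import Data.Fin.Subset.Properties using (∣p∣≤n; ∣∁p∣≡n∸∣p∣)
open import Data.Vec using (lookup; _∷_; [])
open import Data.Vec.Properties using (lookup⇒[]=)
open import Data.Product using (_×_; _,_)
open import Function using (_∘_)
open import Relation.Binary.PropositionalEquality using (_≡_; refl; sym; trans; cong; cong₂; module ≡-Reasoning)

∑-cong : ∀ {n} {f g : Fin n → ℕ} → (∀ i → f i ≡ g i) → ∑ f ≡ ∑ g
∑-cong {zero}  f≗g = refl
∑-cong {suc n} f≗g = cong₂ _+_ (f≗g F.zero) (∑-cong (f≗g ∘ F.suc))

∑-mono-≤ : ∀ {n} {f g : Fin n → ℕ} → (∀ i → f i ≤ g i) → ∑ f ≤ ∑ g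
∑-mono-≤ {zero}  f≤g = ≤-refl
∑-mono-≤ {suc n} f≤g = +-mono-≤ (f≤g F.zero) (∑-mono-≤ (f≤g ∘ F.suc))

∑-distrib-+ : ∀ {n} (f g : Fin n → ℕ) → ∑ (λ i → f i + g i) ≡ ∑ f + ∑ g
∑-distrib-+ {zero}  f g = refl
∑-distrib-+ {suc n} f g =
  trans (cong (f F.zero + g F.zero +_) (∑-distrib-+ (f ∘ F.suc) (g ∘ F.suc)))
        (interchange (f F.zero) (g F.zero) (∑ (f ∘ F.suc)) (∑ (g ∘ F.suc)))

∑pairs-mono-≤ : ∀ {n} {f g : Fin n → Fin n → ℕ} → (∀ i j → f i j ≤ g i j) → ∑pairs f ≤ ∑pairs g
∑pairs-mono-≤ f≤g = ∑-mono-≤ λ i → ∑-mono-≤ λ j → if-mono (toℕ i <ᵇ toℕ j) (f≤g i j)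
  where
  if-mono : ∀ b {m n} → m ≤ n → (if b then m else 0) ≤ (if b then n else 0)
  if-mono true  m≤n = m≤n
  if-mono false _   = z≤n

∑pairs-distrib-+ : ∀ {n} (f g : Fin n → Fin n → ℕ) →
                   ∑pairs (λ i j → f i j + g i j) ≡ ∑pairs f + ∑pairs g
∑pairs-distrib-+ {n} f g =
  trans (∑-cong λ i → trans (∑-cong λ j → if-distrib (toℕ i <ᵇ toℕ j) (f i j) (g i j))
                            (∑-distrib-+ (above f i) (above g i)))
        (∑-distrib-+ (∑ ∘ above f) (∑ ∘ above g))
  where
  above : (Fin n → Fin n → ℕ) → Fin n → Fin n → ℕ
  above h i j = if toℕ i <ᵇ toℕ j then h i j else 0
  if-distrib : ∀ b l m → (if b then l + m else 0) ≡ (if b then l else 0) + (if b then m else 0)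
  if-distrib true  l m = refl
  if-distrib false l m = refl

spread : ∀ {n} → (Fin n → ℕ) → ℕ
spread x = ∑pairs λ i j → ∣ x i - x j ∣

∣m-n∣≤∣m+o-n+p∣+∣o-p∣ : ∀ m n o p → ∣ m - n ∣ ≤ ∣ m + o - n + p ∣ + ∣ o - p ∣
∣m-n∣≤∣m+o-n+p∣+∣o-p∣ m n o p = begin
  ∣ m - n ∣
    ≡⟨ sym (∣m+n-m+o∣≡∣n-o∣ p m n) ⟩
  ∣ p + m - p + n ∣
    ≡⟨ cong₂ ∣_-_∣ (+-comm p m) (+-comm p n) ⟩
  ∣ m + p - n + p ∣
    ≤⟨ ∣-∣-triangle (m + p) (m + o) (n + p) ⟩
  ∣ m + p - m + o ∣ + ∣ m + o - n + p ∣
    ≡⟨ cong (_+ ∣ m + o - n + p ∣) (trans (∣m+n-m+o∣≡∣n-o∣ m p o) (∣-∣-comm p o)) ⟩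
  ∣ o - p ∣ + ∣ m + o - n + p ∣
    ≡⟨ +-comm ∣ o - p ∣ _ ⟩
  ∣ m + o - n + p ∣ + ∣ o - p ∣ ∎
  where open ≤-Reasoning

spread-triangle : ∀ {n} (x y : Fin n → ℕ) → spread x ≤ spread (λ i → x i + y i) + spread y
spread-triangle x y = begin
  spread x
    ≤⟨ ∑pairs-mono-≤ (λ i j → ∣m-n∣≤∣m+o-n+p∣+∣o-p∣ (x i) (x j) (y i) (y j)) ⟩
  ∑pairs (λ i j → ∣ x i + y i - x j + y j ∣ + ∣ y i - y j ∣)
    ≡⟨ ∑pairs-distrib-+ (λ i j → ∣ x i + y i - x j + y j ∣) (λ i j → ∣ y i - y j ∣) ⟩
  spread (λ i → x i + y i) + spread y ∎
  where open ≤-Reasoning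

indicator : ∀ {n} → Subset n → Fin n → ℕ
indicator p i = if lookup p i then 1 else 0

∑-indicator : ∀ {n} (p : Subset n) → ∑ (indicator p) ≡ ∣ p ∣
∑-indicator []          = refl
∑-indicator (true  ∷ p) = cong suc (∑-indicator p)
∑-indicator (false ∷ p) = ∑-indicator p

∑∣1-indicator∣≡∣∁p∣ : ∀ {n} (p : Subset n) → ∑ (λ i → ∣ 1 - indicator p i ∣) ≡ ∣ ∁ p ∣
∑∣1-indicator∣≡∣∁p∣ []          = refl
∑∣1-indicator∣≡∣∁p∣ (true  ∷ p) = ∑∣1-indicator∣≡∣∁p∣ p
∑∣1-indicator∣≡∣∁p∣ (false ∷ p) = cong suc (∑∣1-indicator∣≡∣∁p∣ p)

spread-indicator : ∀ {n} (p : Subset n) → spread (indicator p) ≡ ∣ p ∣ * ∣ ∁ p ∣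
spread-indicator []          = refl
spread-indicator (true  ∷ p) = cong₂ _+_ (∑∣1-indicator∣≡∣∁p∣ p) (spread-indicator p)
spread-indicator (false ∷ p) =
  trans (cong₂ _+_ (∑-indicator p) (spread-indicator p)) (sym (*-suc ∣ p ∣ ∣ ∁ p ∣))

∣p∣+∣∁p∣≡n : ∀ {n} (p : Subset n) → ∣ p ∣ + ∣ ∁ p ∣ ≡ n
∣p∣+∣∁p∣≡n p = trans (cong (∣ p ∣ +_) (∣∁p∣≡n∸∣p∣ p)) (m+[n∸m]≡n (∣p∣≤n p))

∑-bump : ∀ {n} (S : Subset n) (x : Fin n → ℕ) → ∑ (bump S x) ≡ ∑ x + ∣ S ∣
∑-bump S x = trans (∑-distrib-+ x (indicator S)) (cong (∑ x +_) (∑-indicator S))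

square-+-if : ∀ m b → (b ≡ true → m ≡ 0) →
              (m + (if b then 1 else 0)) * (m + (if b then 1 else 0)) ≡ m * m + (if b then 1 else 0)
square-+-if m false _ rewrite +-identityʳ m = sym (+-identityʳ (m * m))
square-+-if m true  m≡0 rewrite m≡0 refl = refl

Φ-bump : ∀ {n} (S : Subset n) (x : Fin n → ℕ) → (∀ i → i ∈ S → x i ≡ 0) → Φ (bump S x) ≡ Φ x + ∣ S ∣
Φ-bump S x x≡0-on-S = begin
  Φ (bump S x)
    ≡⟨ ∑-cong (λ i → square-+-if (x i) (lookup S i) (x≡0-on-S i ∘ lookup⇒[]= i S)) ⟩
  ∑ (λ i → x i * x i + indicator S i)
    ≡⟨ ∑-distrib-+ (λ i → x i * x i) (indicator S) ⟩
  Φ x + ∑ (indicator S)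
    ≡⟨ cong (Φ x +_) (∑-indicator S) ⟩
  Φ x + ∣ S ∣ ∎
  where open ≡-Reasoning

Ψ-bump : ∀ {n} (S : Subset n) (x : Fin n → ℕ) → Ψ x + ∣ S ∣ * ∣ S ∣ ≤ Ψ (bump S x)
Ψ-bump {n} S x = begin
  n * ∑ x + spread x + q * q
    ≤⟨ +-monoˡ-≤ (q * q) (+-monoʳ-≤ (n * ∑ x) (spread-triangle x (indicator S))) ⟩
  n * ∑ x + (spread x′ + spread (indicator S)) + q * q
    ≡⟨ cong (λ s → n * ∑ x + (spread x′ + s) + q * q) (spread-indicator S) ⟩
  n * ∑ x + (spread x′ + q * k) + q * q
    ≡⟨ regroup (n * ∑ x) (spread x′) q k ⟩
  n * ∑ x + q * (q + k) + spread x′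
    ≡⟨ cong (λ m → n * ∑ x + q * m + spread x′) (∣p∣+∣∁p∣≡n S) ⟩
  n * ∑ x + q * n + spread x′
    ≡⟨ factor n (∑ x) q (spread x′) ⟩
  n * (∑ x + q) + spread x′
    ≡⟨ cong (λ m → n * m + spread x′) (sym (∑-bump S x)) ⟩
  n * ∑ x′ + spread x′ ∎
  where
  open ≤-Reasoning
  x′ : Fin n → ℕ
  x′ = bump S x
  q k : ℕ
  q = ∣ S ∣
  k = ∣ ∁ S ∣
  regroup : ∀ a s q k → a + (s + q * k) + q * q ≡ a + q * (q + k) + s
  regroup = solve-∀
  factor : ∀ n a q s → n * a + q * n + s ≡ n * (a + q) + s
  factor = solve-∀

proposition6p3 : (n q : ℕ) (x : Fin n → ℕ) (S : Subset n)
    → (∀ i j → i F.≤ j → x j ≤ x i)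
    → ∣ S ∣ ≡ q
    → (∀ i → i ∈ S → x i ≡ 0)
    → (Φ (bump S x) ≡ Φ x + q) × (Ψ x + q * q ≤ Ψ (bump S x))
proposition6p3 n q x S _ refl x≡0-on-S = Φ-bump S x x≡0-on-S , Ψ-bump S x
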